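{- Let $G$ be a finite simple graph without isolated vertices and with maximum degree $\Delta(G)$. Let $\Phi$ be a trc-partition of $G$ of cardinality $C_{tr}(G)$. Then for every $X\in\Phi$, the number of sets $Y\in\Phi$ such that $X$ and $Y$ form a total restrained coalition is at most $\Delta(G)$.
   Context: A set $S\subseteq V$ is a total restrained dominating set (TRD-set) of $G=(V,E)$ if every vertex of $V\setminus S$ is adjacent to at least one vertex of $S$ and to at least one other vertex of $V\setminus S$, and every vertex of $S$ is adjacent to at least one other vertex of $S$. Two disjoint sets $X,Y\subseteq V$ form a total restrained coalition if neither is a TRD-set but $X\cup Y$ is a TRD-set. A trc-partition of $G$ is a partition $\Phi$ of $V$ such that no member of $\Phi$ is a TRD-set and each member forms a total restrained coalition with some other member of $\Phi$. $C_{tr}(G)$ is the maximum cardinality of a trc-partition of $G$. -}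

module Defs where

open import Data.Nat using (ℕ; _+_; _⊔_; _≤_)
open import Data.Bool using (Bool; true; false; T; if_then_else_)
open import Data.Fin using (Fin)
open import Data.List using (List; map; foldr; allFin)
open import Data.Nat.ListAction using (sum)
open import Data.Product using (Σ; ∃; _×_; _,_)
open import Data.Sum using (_⊎_)
open import Relation.Nullary using (¬_)
open import Data.Empty using (⊥)
open import Relation.Binary.PropositionalEquality using (_≡_; _≢_)

record Graph (n : ℕ) : Set where
  field
    adj   : Fin n → Fin n → Bool
    sym   : ∀ u v → adj u v ≡ adj v u
    irrefl : ∀ v → adj v v ≡ false

module _ {n : ℕ} (G : Graph n) where
  open Graph G

  Adj : Fin n → Fin n → Set
  Adj u v = T (adj u v)

  degree : Fin n → ℕ
  degree v = sum (map (λ u → if adj v u then 1 else 0) (allFin n))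

  maxDegree : ℕ
  maxDegree = foldr _⊔_ 0 (map degree (allFin n))

  NoIsolated : Set
  NoIsolated = ∀ v → ∃ λ u → Adj v u

  VSet : Set₁
  VSet = Fin n → Set

  IsTRD : VSet → Set
  IsTRD S =
    (∀ v → ¬ S v → (∃ λ u → S u × Adj v u) × (∃ λ u → ¬ S u × Adj v u))
    × (∀ v → S v → ∃ λ u → S u × Adj v u)

  _∪_ : VSet → VSet → VSet
  (X ∪ Y) v = X v ⊎ Y v

  Disjoint : VSet → VSet → Set
  Disjoint X Y = ∀ v → X v → Y v → ⊥

  TRCoalition : VSet → VSet → Set
  TRCoalition X Y = Disjoint X Y × ¬ IsTRD X × ¬ IsTRD Y × IsTRD (X ∪ Y)

  -- A partition of V into k (nonempty) classes, given by a class map f : Fin n → Fin k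
  -- that is surjective; class i is { v | f v ≡ i }.
  Class : ∀ {k} → (Fin n → Fin k) → Fin k → VSet
  Class f i v = f v ≡ i

  IsPartition : ∀ k → (Fin n → Fin k) → Set
  IsPartition k f = ∀ (i : Fin k) → ∃ λ v → f v ≡ i

  IsTrcPartition : ∀ k → (Fin n → Fin k) → Set
  IsTrcPartition k f =
    IsPartition k f
    × (∀ i → ¬ IsTRD (Class f i))
    × (∀ i → ∃ λ j → j ≢ i × TRCoalition (Class f i) (Class f j))

  IsMaxTrcPartition : ∀ k → (Fin n → Fin k) → Set
  IsMaxTrcPartition k f =
    IsTrcPartition k f × (∀ k' (f' : Fin n → Fin k') → IsTrcPartition k' f' → k' ≤ k)

-- Since the class X is not a TRD-set, some vertex v witnesses this: either v
-- has no neighbour in X, or v ∉ X and all neighbours of v lie in X. In the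
-- first case, for each coalition partner Y the TRD-set X ∪ Y gives v a
-- neighbour, necessarily in Y; the partners are distinct classes, so these
-- neighbours are distinct and their number is at most deg v ≤ Δ(G). In the
-- second case v must lie in every partner Y (otherwise v ∉ X ∪ Y has no
-- neighbour outside X ∪ Y), so there is at most one partner, and Δ(G) ≥ 1
-- because G has no isolated vertex.
module Submission where

open import Data.Bool using (Bool; true; false; T; if_then_else_)
open import Data.Fin using (Fin; zero; suc)
open import Data.Fin.Properties using (any?; all?; injective⇒≤; suc-injective) renaming (_≟_ to _≟ᶠ_)
open import Data.List using (foldr; tabulate)
open import Data.List.Properties using (map-tabulate)
open import Data.Nat using (ℕ; _≤_; _⊔_)
open import Data.Nat.ListAction using (sum)
open import Data.Nat.Properties using (≤-trans; m≤m⊔n; m≤n⊔m)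
open import Data.Product using (∃; _×_; _,_; proj₁; proj₂)
open import Data.Sum using (_⊎_; inj₁; inj₂; [_,_]′)
open import Function using (_∘_; id)
open import Function.Definitions using (Injective)
open import Relation.Binary.PropositionalEquality using (_≡_; refl; sym; trans; cong)
open import Relation.Nullary using (¬_; Dec; yes; no; contradiction)
open import Relation.Nullary.Decidable using (T?; ¬?; _×-dec_; _⊎-dec_; _→-dec_; decidable-stable)
open import Relation.Unary using (∁; Decidable)

open import Defs

count : ∀ {n} → (Fin n → Bool) → ℕ
count p = sum (tabulate (λ x → if p x then 1 else 0))

-- The position of x among the true entries of p.
rank : ∀ {n} (p : Fin n → Bool) x → T (p x) → Fin (count p)
rank p zero px with p zero
rank p zero _  | true = zero
rank p (suc x) px with p zero
... | true  = suc (rank (p ∘ suc) x px)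
... | false = rank (p ∘ suc) x px

rank-injective : ∀ {n} (p : Fin n → Bool) {x y} (px : T (p x)) (py : T (p y)) →
                 rank p x px ≡ rank p y py → x ≡ y
rank-injective p {zero}  {zero}  _  _  _ = refl
rank-injective p {zero}  {suc y} px py e with p zero
rank-injective p {zero}  {suc y} _  _  () | true
rank-injective p {suc x} {zero}  px py e with p zero
rank-injective p {suc x} {zero}  _  _  () | true
rank-injective p {suc x} {suc y} px py e with p zero
... | true  = cong suc (rank-injective (p ∘ suc) px py (suc-injective e))
... | false = cong suc (rank-injective (p ∘ suc) px py e)

injective-into-true⇒≤count : ∀ {m n} (p : Fin n → Bool) {h : Fin m → Fin n} →
                             Injective _≡_ _≡_ h → (∀ t → T (p (h t))) → m ≤ count p
injective-into-true⇒≤count p h-inj ph = injective⇒≤ (h-inj ∘ rank-injective p (ph _) (ph _))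

constant-injective⇒≤1 : ∀ {a} {A : Set a} {m} {g : Fin m → A} {c : A} →
                        Injective _≡_ _≡_ g → (∀ t → g t ≡ c) → m ≤ 1
constant-injective⇒≤1 g-inj g≡c =
  injective⇒≤ {f = λ _ → zero} (λ {s} {t} _ → g-inj (trans (g≡c s) (sym (g≡c t))))

foldr-⊔-tabulate-≥ : ∀ {n} (q : Fin n → ℕ) x → q x ≤ foldr _⊔_ 0 (tabulate q)
foldr-⊔-tabulate-≥ q zero    = m≤m⊔n (q zero) _
foldr-⊔-tabulate-≥ q (suc x) = ≤-trans (foldr-⊔-tabulate-≥ (q ∘ suc) x) (m≤n⊔m (q zero) _)

module _ {n : ℕ} (G : Graph n) where
  open Graph G using (adj)

  degree≡count : ∀ v → degree G v ≡ count (adj v)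
  degree≡count v = cong sum (map-tabulate id (λ u → if adj v u then 1 else 0))

  degree≤maxDegree : ∀ v → degree G v ≤ maxDegree G
  degree≤maxDegree v rewrite map-tabulate id (degree G) = foldr-⊔-tabulate-≥ (degree G) v

  Adj? : ∀ v u → Dec (Adj G v u)
  Adj? v u = T? (adj v u)

  injective-into-neighbours⇒≤degree : ∀ {m} v {h : Fin m → Fin n} → Injective _≡_ _≡_ h →
                                      (∀ t → Adj G v (h t)) → m ≤ degree G v
  injective-into-neighbours⇒≤degree v h-inj h-adj rewrite degree≡count v =
    injective-into-true⇒≤count (adj v) h-inj h-adj

  neighbours-in-distinct-classes⇒≤degree :
    ∀ {k m} (f : Fin n → Fin k) {g : Fin m → Fin k} → Injective _≡_ _≡_ g →
    ∀ v → (∀ t → ∃ λ u → Class G f (g t) u × Adj G v u) → m ≤ degree G v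
  neighbours-in-distinct-classes⇒≤degree f g-inj v nbr =
    injective-into-neighbours⇒≤degree v h-inj (proj₂ ∘ proj₂ ∘ nbr)
    where
    h-inj : Injective _≡_ _≡_ (proj₁ ∘ nbr)
    h-inj {s} {t} e = g-inj (trans (sym (proj₁ (proj₂ (nbr s))))
                                   (trans (cong f e) (proj₁ (proj₂ (nbr t)))))

  NoIsolated⇒1≤degree : NoIsolated G → ∀ v → 1 ≤ degree G v
  NoIsolated⇒1≤degree noIso v =
    injective-into-neighbours⇒≤degree v {h = λ _ → proj₁ (noIso v)}
      (λ { {zero} {zero} _ → refl }) (λ _ → proj₂ (noIso v))

  NoNeighbourIn : VSet G → Fin n → Set
  NoNeighbourIn S v = ∀ u → S u → ¬ Adj G v u

  -- Lacking a neighbour in S is a violation whether or not v ∈ S.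
  TRDViolation : VSet G → Fin n → Set
  TRDViolation S v = NoNeighbourIn S v ⊎ (¬ S v × NoNeighbourIn (∁ S) v)

  neighbourIn : ∀ {S : VSet G} → Decidable S → ∀ v → ¬ NoNeighbourIn S v → ∃ λ u → S u × Adj G v u
  neighbourIn S? v ¬none = decidable-stable (any? (λ u → S? u ×-dec Adj? v u))
                                            (λ ¬∃ → ¬none (λ u Su a → ¬∃ (u , Su , a)))

  module _ {S : VSet G} (S? : Decidable S) where

    TRDViolation? : Decidable (TRDViolation S)
    TRDViolation? v = none? S? ⊎-dec (¬? (S? v) ×-dec none? (¬? ∘ S?))
      where
      none? : ∀ {T : VSet G} → Decidable T → Dec (NoNeighbourIn T v)
      none? T? = all? (λ u → T? u →-dec ¬? (Adj? v u))

    ¬IsTRD⇒violation : ¬ IsTRD G S → ∃ (TRDViolation S)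
    ¬IsTRD⇒violation ¬trd with any? TRDViolation?
    ... | yes violation = violation
    ... | no ¬violation = contradiction ((λ v ¬Sv → inS v , outS v ¬Sv) , (λ v _ → inS v)) ¬trd
      where
      inS : ∀ v → ∃ λ u → S u × Adj G v u
      inS v = neighbourIn S? v (λ none → ¬violation (v , inj₁ none))
      outS : ∀ v → ¬ S v → ∃ λ u → ¬ S u × Adj G v u
      outS v ¬Sv = neighbourIn (¬? ∘ S?) v (λ none → ¬violation (v , inj₂ (¬Sv , none)))

  IsTRD⇒neighbourIn : ∀ {S : VSet G} → Decidable S → IsTRD G S → ∀ v → ∃ λ u → S u × Adj G v u
  IsTRD⇒neighbourIn S? (outside , inside) v with S? v
  ... | yes Sv  = inside v Sv
  ... | no  ¬Sv = proj₁ (outside v ¬Sv)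

  module _ {X Y : VSet G} (X? : Decidable X) (Y? : Decidable Y) (X∪Y-TRD : IsTRD G (_∪_ G X Y)) where

    neighbourInPartner : ∀ {v} → NoNeighbourIn X v → ∃ λ u → Y u × Adj G v u
    neighbourInPartner {v} none with IsTRD⇒neighbourIn (λ w → X? w ⊎-dec Y? w) X∪Y-TRD v
    ... | u , inj₁ Xu , a = contradiction a (none u Xu)
    ... | u , inj₂ Yu , a = u , Yu , a

    partnerContains : ∀ {v} → ¬ X v → NoNeighbourIn (∁ X) v → Y v
    partnerContains {v} ¬Xv none with Y? v
    ... | yes Yv  = Yv
    ... | no  ¬Yv with proj₂ (proj₁ X∪Y-TRD v [ ¬Xv , ¬Yv ]′)
    ...   | u , ¬X∪Yu , a = contradiction a (none u (¬X∪Yu ∘ inj₁))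

  Class? : ∀ {k} (f : Fin n → Fin k) i → Decidable (Class G f i)
  Class? f i v = f v ≟ᶠ i

lemma2p9 : ∀ {n} (G : Graph n) → NoIsolated G
    → ∀ k (f : Fin n → Fin k) → IsMaxTrcPartition G k f
    → ∀ (i : Fin k) (m : ℕ) (g : Fin m → Fin k) → Injective _≡_ _≡_ g
    → (∀ t → TRCoalition G (Class G f i) (Class G f (g t)))
    → m ≤ maxDegree G
lemma2p9 G noIso k f ((_ , ¬TRD , _) , _) i m g g-inj coal =
  boundBy (¬IsTRD⇒violation G X? (¬TRD i))
  where
  X? : Decidable (Class G f i)
  X? = Class? G f i
  Y? : ∀ t → Decidable (Class G f (g t))
  Y? t = Class? G f (g t)
  X∪Y-TRD : ∀ t → IsTRD G (_∪_ G (Class G f i) (Class G f (g t)))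
  X∪Y-TRD t = proj₂ (proj₂ (proj₂ (coal t)))

  boundBy : ∃ (TRDViolation G (Class G f i)) → m ≤ maxDegree G
  boundBy (v , inj₁ none) =
    ≤-trans (neighbours-in-distinct-classes⇒≤degree G f g-inj v
               (λ t → neighbourInPartner G X? (Y? t) (X∪Y-TRD t) none))
            (degree≤maxDegree G v)
  boundBy (v , inj₂ (¬Xv , none)) =
    ≤-trans (constant-injective⇒≤1 g-inj (λ t → sym (partnerContains G X? (Y? t) (X∪Y-TRD t) ¬Xv none)))
            (≤-trans (NoIsolated⇒1≤degree G noIso v) (degree≤maxDegree G v))
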